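{- Let $G$ be a finite group and $S$ an inverse-closed generating set of $G$ not containing the identity $1_G$. Let $\hat G=\mathbb{Z}_2\wr G$ and let $\hat S=\{(\mathbf{a}_{1_G},1_G)\}\cup\{(\mathbf{e},s)\mid s\in S\}$ be the canonical generating set of $\hat G$ with respect to $S$. If $\mathrm{Cay}(G,S)$ is bipartite and has an induced subgraph of maximum degree $1$ on a set of more than half its vertices, then $\mathrm{Cay}(\hat G,\hat S)$ is bipartite and has an induced subgraph of maximum degree $1$ on a set of more than half its vertices.
   Context: For a group $G$ and an inverse-closed subset $S\subseteq G$ not containing the identity, the Cayley graph $\mathrm{Cay}(G,S)$ has vertex set $G$, with $g,h$ adjacent iff $g^{ -1}h\in S$. Let $\mathbb{Z}_2=\{0,1\}$ be the cyclic group of order $2$ and $(\mathbb{Z}_2)^G$ the group of functions $G\to\mathbb{Z}_2$ under pointwise addition, with identity $\mathbf{e}$ (the zero function). $G$ acts on $(\mathbb{Z}_2)^G$ by $\mathbf{a}^g(x)=\mathbf{a}(g^{ -1}x)$. The wreath product $\mathbb{Z}_2\wr G$ is the set of pairs $(\mathbf{a},g)$ with $\mathbf{a}\in(\mathbb{Z}_2)^G$, $g\in G$, with multiplication $(\mathbf{a},g)(\mathbf{b},h)=(\mathbf{a}+\mathbf{b}^g,gh)$. For $g\in G$, $\mathbf{a}_g\in(\mathbb{Z}_2)^G$ denotes the function mapping $g$ to $1$ and all other elements to $0$. -}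

module Defs where

open import Data.Nat using (ℕ; zero; suc; _+_; _*_; _⊔_; _>_)
open import Data.Bool using (Bool; true; false; _∧_; _∨_; _xor_; if_then_else_)
open import Data.Fin using (Fin)
open import Data.Fin.Properties using () renaming (_≟_ to _≟ᶠ_)
open import Data.Vec using (Vec; []; _∷_; tabulate; lookup; zipWith; replicate; updateAt)
open import Data.Vec.Properties using (≡-dec)
open import Data.List using (List; []; _∷_; [_]; length; filter; map; foldr; concatMap; allFin; cartesianProduct)
open import Data.List.Relation.Unary.All using (All)
open import Data.Product using (Σ; ∃; _×_; _,_)
open import Relation.Binary.PropositionalEquality using (_≡_; _≢_)
open import Relation.Nullary.Decidable using (⌊_⌋)
open import Algebra.Structures using (IsGroup)
import Data.Bool.Properties as BoolP

record FinGroup : Set₁ where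
  field
    n       : ℕ
    _∙_     : Fin n → Fin n → Fin n
    ε       : Fin n
    _⁻¹     : Fin n → Fin n
    isGroup : IsGroup _≡_ _∙_ ε _⁻¹

  elems : List (Fin n)
  elems = allFin n

-- Finite (simple, undirected by construction for Cayley graphs) graphs:
-- a vertex type with an explicit enumeration (each vertex exactly once)
-- and a Boolean adjacency relation.

record FinGraph : Set₁ where
  field
    V     : Set
    verts : List V
    adj   : V → V → Bool

module _ (Γ : FinGraph) where
  open FinGraph Γ

  count : (V → Bool) → ℕ
  count P = length (filter (λ v → P v Data.Bool.≟ true) verts)

  inducedDegree : (V → Bool) → V → ℕ
  inducedDegree U u = count (λ v → U v ∧ adj u v)

  -- maximum degree of the subgraph induced on U (0 if U is empty)
  inducedMaxDegree : (V → Bool) → ℕ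
  inducedMaxDegree U =
    foldr _⊔_ 0 (map (inducedDegree U) (filter (λ v → U v Data.Bool.≟ true) verts))

  IsBipartite : Set
  IsBipartite = Σ (V → Bool) λ c → ∀ u v → adj u v ≡ true → c u ≢ c v

  HasLargeMaxDeg1Subgraph : Set
  HasLargeMaxDeg1Subgraph =
    Σ (V → Bool) λ U → (2 * count U > length verts) × (inducedMaxDegree U ≡ 1)

module _ (G : FinGroup) where
  open FinGroup G

  InverseClosed : (Fin n → Bool) → Set
  InverseClosed S = ∀ s → S s ≡ true → S (s ⁻¹) ≡ true

  Generates : (Fin n → Bool) → Set
  Generates S = ∀ g → Σ (List (Fin n)) λ ss →
    All (λ s → S s ≡ true) ss × foldr _∙_ ε ss ≡ g

  Cay : (Fin n → Bool) → FinGraph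
  Cay S = record { V = Fin n ; verts = elems ; adj = λ g h → S ((g ⁻¹) ∙ h) }

  -- (Z₂)^G, with functions G → Z₂ represented as vectors indexed by Fin n
  -- (Z₂ = Bool, addition = xor).
  Z2G : Set
  Z2G = Vec Bool n

  _+ᶻ_ : Z2G → Z2G → Z2G
  _+ᶻ_ = zipWith _xor_

  eᶻ : Z2G
  eᶻ = replicate n false

  aᶻ : Fin n → Z2G
  aᶻ g = tabulate λ x → ⌊ x ≟ᶠ g ⌋

  act : Z2G → Fin n → Z2G
  act a g = tabulate λ x → lookup a ((g ⁻¹) ∙ x)

  Wr : Set
  Wr = Z2G × Fin n

  _∙ʷ_ : Wr → Wr → Wr
  (a , g) ∙ʷ (b , h) = (a +ᶻ act b g) , (g ∙ h)

  -- inverse: (a , g)⁻¹ = (a^{g⁻¹} , g⁻¹)   (in Z₂, -x = x)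
  invʷ : Wr → Wr
  invʷ (a , g) = act a (g ⁻¹) , (g ⁻¹)

  allVecs : (m : ℕ) → List (Vec Bool m)
  allVecs zero    = [ [] ]
  allVecs (suc m) = concatMap (λ v → (false ∷ v) ∷ (true ∷ v) ∷ []) (allVecs m)

  wrElems : List Wr
  wrElems = cartesianProduct (allVecs n) elems

  Ŝ : (Fin n → Bool) → Wr → Bool
  Ŝ S (a , g) =
    (⌊ g ≟ᶠ ε ⌋ ∧ ⌊ ≡-dec BoolP._≟_ a (aᶻ ε) ⌋) ∨ (⌊ ≡-dec BoolP._≟_ a eᶻ ⌋ ∧ S g)

  CayWr : (Fin n → Bool) → FinGraph
  CayWr S = record { V = Wr ; verts = wrElems ; adj = λ x y → Ŝ S (invʷ x ∙ʷ y) }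

module Submission where

-- Write Ŵ = Cay(Z₂ ≀ G, Ŝ) and Γ = Cay(G, S).  Every edge of Ŵ
-- either toggles the lamp at the lamplighter's position g, or moves him from g to a
-- Γ-neighbour h keeping all lamps (adjacency-cases).
-- * Bipartite: colour (a , g) by c(g) + (number of lit lamps) mod 2.
-- * Large sparse set: fix a proper colouring d of Γ whose black class is the smaller
--   one and a set U with |U| > |G|/2 of maximum induced degree 1.  Let Û consist of
--   the (a , g) such that: g is white if the lamps lit on black positions are odd in
--   number; otherwise g is black if the lamps lit on white positions are odd; otherwise
--   g ∈ U.  A finite case analysis shows that inside Û a toggle edge occurs only in the
--   first layer and a move edge only in the third, so every vertex of Û has at most one
--   Û-neighbour; the all-lamps-off copy of an edge inside U is an edge inside Û.
--   Toggling a lamp at a white (resp. black) position flips exactly one of the two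
--   parities, so each parity pattern occurs for a quarter of all lamp configurations;
--   hence 4|Û| = 2^|G| (|U| + |black| + 2|white|) > 2 · 2^|G| |G|.

open import Defs
open import Algebra.Bundles using (Group)
import Algebra.Properties.Group as GroupProperties
open import Data.Bool using (Bool; true; false; not; _∧_; _xor_; if_then_else_)
open import Data.Bool.Properties
  using (not-injective; not-involutive; not-¬; not-distribˡ-xor; not-distribʳ-xor;
         xor-comm; xor-assoc; xor-same; xor-identityʳ; ∧-zeroʳ; ∨-zeroʳ)
  renaming (_≟_ to _≟ᵇ_)
open import Data.Fin using (Fin; zero; suc)
open import Data.Fin.Properties using () renaming (_≟_ to _≟ᶠ_)
open import Data.List using (List; []; _∷_; _++_; map; filter; length; foldr; concatMap; allFin; tabulate; cartesianProduct)
open import Data.List.Properties using (foldr-preservesᵇ; foldr-preservesᵒ; map-tabulate)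
open import Data.List.Membership.Propositional using (_∈_)
open import Data.List.Membership.Propositional.Properties
  using (∈-map⁺; ∈-map⁻; ∈-filter⁺; ∈-filter⁻; ∈-concatMap⁺; ∈-cartesianProduct⁺; ∈-allFin)
open import Data.List.Relation.Unary.All using (All)
import Data.List.Relation.Unary.All as All
import Data.List.Relation.Unary.All.Properties as All
open import Data.List.Relation.Unary.Any using (here; there)
import Data.List.Relation.Unary.Any as Any
open import Data.Nat using (ℕ; zero; suc; _+_; _*_; _^_; _⊔_; _≤_; _<_; _>_; z≤n; >-nonZero)
open import Data.Nat.Properties
  using (+-identityʳ; +-assoc; +-comm; +-suc; *-identityˡ; *-assoc; *-distribʳ-+;
         +-commutativeSemigroup; ≤-refl; ≤-reflexive; ≤-trans; ≤-antisym; ≤-total; ≤-<-trans;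
         m≤m+n; m≤n+m; +-mono-≤; +-monoʳ-≤; +-monoˡ-<; *-monoʳ-<; *-cancelˡ-<; m^n>0;
         ⊔-lub; ⊔-sel; m≤n⇒m≤n⊔o; m≤n⇒m≤o⊔n; module ≤-Reasoning)
open import Data.Nat.Tactic.RingSolver using (solve-∀)
open import Algebra.Properties.CommutativeSemigroup +-commutativeSemigroup
  using () renaming (interchange to +-interchange)
open import Data.Product using (Σ-syntax; _×_; _,_; proj₁; proj₂)
open import Data.Sum using (_⊎_; inj₁; inj₂; [_,_])
open import Data.Vec using (Vec; []; _∷_; lookup; replicate; updateAt)
import Data.Vec as Vec
open import Data.Vec.Properties
  using (lookup∘updateAt; lookup∘updateAt′; lookup-zipWith; lookup∘tabulate; lookup-replicate;
         tabulate∘lookup; tabulate-cong; zipWith-replicate; ≡-dec)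
open import Function using (_∘_)
open import Relation.Binary.PropositionalEquality hiding ([_])
open import Relation.Nullary using (Dec; yes; no; contradiction)
open import Relation.Nullary.Decidable using (⌊_⌋; does; dec-true)

private variable
  A B : Set
  m   : ℕ

∧-true : (x y : Bool) → x ∧ y ≡ true → x ≡ true × y ≡ true
∧-true true y y≡true = refl , y≡true

xor-true : (x : Bool) → x xor true ≡ not x
xor-true x = sym (xor-comm true x)

xor-solve : (x y z : Bool) → x xor y ≡ z → y ≡ x xor z
xor-solve x y z x⊕y≡z = begin
  y               ≡⟨ cong (_xor y) (xor-same x) ⟨
  (x xor x) xor y ≡⟨ xor-assoc x x y ⟩
  x xor (x xor y) ≡⟨ cong (x xor_) x⊕y≡z ⟩
  x xor z         ∎
  where open ≡-Reasoning

xor-cancelʳ : (x y z : Bool) → x xor z ≡ y xor z → x ≡ y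
xor-cancelʳ x y z x⊕z≡y⊕z = begin
  x                ≡⟨ xor-twice x ⟨
  (x xor z) xor z  ≡⟨ cong (_xor z) x⊕z≡y⊕z ⟩
  (y xor z) xor z  ≡⟨ xor-twice y ⟩
  y                ∎
  where
  open ≡-Reasoning
  xor-twice : ∀ w → (w xor z) xor z ≡ w
  xor-twice w = trans (xor-assoc w z z) (trans (cong (w xor_) (xor-same z)) (xor-identityʳ w))

⌊⌋-agree : {P Q : Set} → (P → Q) → (Q → P) → (p? : Dec P) (q? : Dec Q) → ⌊ p? ⌋ ≡ ⌊ q? ⌋
⌊⌋-agree P→Q Q→P (yes p) (yes q) = refl
⌊⌋-agree P→Q Q→P (yes p) (no ¬q) = contradiction (P→Q p) ¬q
⌊⌋-agree P→Q Q→P (no ¬p) (yes q) = contradiction (Q→P q) ¬p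
⌊⌋-agree P→Q Q→P (no ¬p) (no ¬q) = refl

indicator : Bool → ℕ
indicator true  = 1
indicator false = 0

∑ : List A → (A → ℕ) → ℕ
∑ []       f = 0
∑ (x ∷ xs) f = f x + ∑ xs f

tally : (A → Bool) → List A → ℕ
tally P xs = length (filter (λ x → P x ≟ᵇ true) xs)

tally≡∑ : (P : A → Bool) (xs : List A) → tally P xs ≡ ∑ xs (indicator ∘ P)
tally≡∑ P []       = refl
tally≡∑ P (x ∷ xs) with P x
... | true  = cong suc (tally≡∑ P xs)
... | false = tally≡∑ P xs

length≡∑ : (xs : List A) → length xs ≡ ∑ xs (λ _ → 1)
length≡∑ []       = refl
length≡∑ (x ∷ xs) = cong suc (length≡∑ xs)

∑-zero : (xs : List A) → ∑ xs (λ _ → 0) ≡ 0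
∑-zero []       = refl
∑-zero (_ ∷ xs) = ∑-zero xs

∑-cong : {f g : A → ℕ} → (∀ x → f x ≡ g x) → (xs : List A) → ∑ xs f ≡ ∑ xs g
∑-cong f≗g []       = refl
∑-cong f≗g (x ∷ xs) = cong₂ _+_ (f≗g x) (∑-cong f≗g xs)

∑-mono : {f g : A → ℕ} → (∀ x → f x ≤ g x) → (xs : List A) → ∑ xs f ≤ ∑ xs g
∑-mono f≤g []       = z≤n
∑-mono f≤g (x ∷ xs) = +-mono-≤ (f≤g x) (∑-mono f≤g xs)

∑-+ : (f g : A → ℕ) (xs : List A) → ∑ xs (λ x → f x + g x) ≡ ∑ xs f + ∑ xs g
∑-+ f g []       = refl
∑-+ f g (x ∷ xs) =
  trans (cong (f x + g x +_) (∑-+ f g xs)) (+-interchange (f x) (g x) (∑ xs f) (∑ xs g))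

∑-*ʳ : (f : A → ℕ) (k : ℕ) (xs : List A) → ∑ xs (λ x → f x * k) ≡ ∑ xs f * k
∑-*ʳ f k []       = refl
∑-*ʳ f k (x ∷ xs) = trans (cong (f x * k +_) (∑-*ʳ f k xs)) (sym (*-distribʳ-+ k (f x) (∑ xs f)))

∑-++ : (xs ys : List A) (f : A → ℕ) → ∑ (xs ++ ys) f ≡ ∑ xs f + ∑ ys f
∑-++ []       ys f = refl
∑-++ (x ∷ xs) ys f = trans (cong (f x +_) (∑-++ xs ys f)) (sym (+-assoc (f x) _ _))

∑-map : (g : A → B) (xs : List A) (f : B → ℕ) → ∑ (map g xs) f ≡ ∑ xs (f ∘ g)
∑-map g []       f = refl
∑-map g (x ∷ xs) f = cong (f (g x) +_) (∑-map g xs f)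

∑-cartesianProduct : (xs : List A) (ys : List B) (f : A × B → ℕ) →
  ∑ (cartesianProduct xs ys) f ≡ ∑ xs (λ x → ∑ ys (λ y → f (x , y)))
∑-cartesianProduct []       ys f = refl
∑-cartesianProduct (x ∷ xs) ys f =
  trans (∑-++ (map (x ,_) ys) (cartesianProduct xs ys) f)
        (cong₂ _+_ (∑-map (x ,_) ys f) (∑-cartesianProduct xs ys f))

∑-member : {x : A} {xs : List A} (f : A → ℕ) → x ∈ xs → f x ≤ ∑ xs f
∑-member f (here refl) = m≤m+n _ _
∑-member {xs = y ∷ xs} f (there x∈xs) = ≤-trans (∑-member f x∈xs) (m≤n+m _ (f y))

tally-member : (P : A → Bool) {x : A} {xs : List A} → x ∈ xs → P x ≡ true → 1 ≤ tally P xs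
tally-member P {x} {xs} x∈xs Px = begin
  1                     ≡⟨ cong indicator (sym Px) ⟩
  indicator (P x)       ≤⟨ ∑-member (indicator ∘ P) x∈xs ⟩
  ∑ xs (indicator ∘ P)  ≡⟨ tally≡∑ P xs ⟨
  tally P xs            ∎
  where open ≤-Reasoning

tally-witness : (P : A → Bool) (xs : List A) → 1 ≤ tally P xs → Σ[ x ∈ A ] x ∈ xs × P x ≡ true
tally-witness P (x ∷ xs) pos with P x in Px
... | true  = x , here refl , Px
... | false with tally-witness P xs pos
...   | y , y∈xs , Py = y , there y∈xs , Py

tally-mono : (P Q : A → Bool) → (∀ x → P x ≡ true → Q x ≡ true) → (xs : List A) → tally P xs ≤ tally Q xs
tally-mono P Q P⊆Q xs = begin
  tally P xs           ≡⟨ tally≡∑ P xs ⟩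
  ∑ xs (indicator ∘ P) ≤⟨ ∑-mono indicator-mono xs ⟩
  ∑ xs (indicator ∘ Q) ≡⟨ tally≡∑ Q xs ⟨
  tally Q xs           ∎
  where
  open ≤-Reasoning
  indicator-mono : ∀ x → indicator (P x) ≤ indicator (Q x)
  indicator-mono x with P x in Px
  ... | true  rewrite P⊆Q x Px = ≤-refl
  ... | false = z≤n

tally-complement : (P : A → Bool) (xs : List A) → tally P xs + tally (not ∘ P) xs ≡ length xs
tally-complement P []       = refl
tally-complement P (x ∷ xs) with P x
... | true  = cong suc (tally-complement P xs)
... | false = trans (+-suc _ _) (cong suc (tally-complement P xs))

tally-cartesianProduct : (P : A × B → Bool) (xs : List A) (ys : List B) →
  tally P (cartesianProduct xs ys) ≡ ∑ xs (λ x → tally (λ y → P (x , y)) ys)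
tally-cartesianProduct P xs ys = begin
  tally P (cartesianProduct xs ys)                       ≡⟨ tally≡∑ P (cartesianProduct xs ys) ⟩
  ∑ (cartesianProduct xs ys) (indicator ∘ P)             ≡⟨ ∑-cartesianProduct xs ys _ ⟩
  ∑ xs (λ x → ∑ ys (λ y → indicator (P (x , y))))        ≡⟨ ∑-cong (λ x → tally≡∑ _ ys) xs ⟨
  ∑ xs (λ x → tally (λ y → P (x , y)) ys)                ∎
  where open ≡-Reasoning

tally-product : (Q : A → Bool) (R : B → Bool) (xs : List A) (ys : List B) →
  tally (λ (x , y) → Q x ∧ R y) (cartesianProduct xs ys) ≡ tally Q xs * tally R ys
tally-product Q R xs ys = begin
  tally (λ (x , y) → Q x ∧ R y) (cartesianProduct xs ys)
    ≡⟨ tally-cartesianProduct _ xs ys ⟩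
  ∑ xs (λ x → tally (λ y → Q x ∧ R y) ys)
    ≡⟨ ∑-cong (λ x → row (Q x)) xs ⟩
  ∑ xs (λ x → indicator (Q x) * tally R ys)
    ≡⟨ ∑-*ʳ (indicator ∘ Q) (tally R ys) xs ⟩
  ∑ xs (indicator ∘ Q) * tally R ys
    ≡⟨ cong (_* tally R ys) (tally≡∑ Q xs) ⟨
  tally Q xs * tally R ys ∎
  where
  open ≡-Reasoning
  row : ∀ c → tally (λ y → c ∧ R y) ys ≡ indicator c * tally R ys
  row true  = sym (+-identityʳ _)
  row false = trans (tally≡∑ _ ys) (∑-zero ys)

foldr-⊔-lub : {k : ℕ} (ns : List ℕ) → All (_≤ k) ns → foldr _⊔_ 0 ns ≤ k
foldr-⊔-lub ns = foldr-preservesᵇ ⊔-lub z≤n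

foldr-⊔-upper : {n : ℕ} {ns : List ℕ} → n ∈ ns → n ≤ foldr _⊔_ 0 ns
foldr-⊔-upper {n} {ns} n∈ns =
  foldr-preservesᵒ (λ x y → [ m≤n⇒m≤n⊔o y , m≤n⇒m≤o⊔n x ]) 0 ns
    (inj₂ (Any.map (λ { refl → ≤-refl }) n∈ns))

foldr-⊔-attained : (ns : List ℕ) {k : ℕ} → foldr _⊔_ 0 ns ≡ suc k → suc k ∈ ns
foldr-⊔-attained (n ∷ ns) max≡ with ⊔-sel n (foldr _⊔_ 0 ns)
... | inj₁ ⊔≡n = here (trans (sym max≡) ⊔≡n)
... | inj₂ ⊔≡m = there (foldr-⊔-attained ns (trans (sym ⊔≡m) max≡))

module InducedSubgraph (Γ : FinGraph) (U : FinGraph.V Γ → Bool) where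
  open FinGraph Γ

  U? : (v : V) → Dec (U v ≡ true)
  U? v = U v ≟ᵇ true

  degree : V → ℕ
  degree = inducedDegree Γ U

  record InnerEdge : Set where
    field
      {u v} : V
      u∈V   : u ∈ verts
      v∈V   : v ∈ verts
      u∈U   : U u ≡ true
      v∈U   : U v ≡ true
      u~v   : adj u v ≡ true

  degree≤maxDegree : {u : V} → u ∈ verts → U u ≡ true → degree u ≤ inducedMaxDegree Γ U
  degree≤maxDegree u∈V u∈U = foldr-⊔-upper (∈-map⁺ degree (∈-filter⁺ U? u∈V u∈U))

  maxDegree≤ : {k : ℕ} → (∀ u → U u ≡ true → degree u ≤ k) → inducedMaxDegree Γ U ≤ k
  maxDegree≤ deg≤ = foldr-⊔-lub _ (All.map⁺ (All.map (deg≤ _) (All.all-filter U? verts)))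

  maxDegree≡1⇒innerEdge : inducedMaxDegree Γ U ≡ 1 → InnerEdge
  maxDegree≡1⇒innerEdge max≡1
    with ∈-map⁻ degree (foldr-⊔-attained _ max≡1)
  ... | u , u∈filter , 1≡deg
    with ∈-filter⁻ U? u∈filter | tally-witness _ verts (≤-reflexive 1≡deg)
  ... | u∈V , u∈U | v , v∈V , Uv∧u~v
    with ∧-true (U v) (adj u v) Uv∧u~v
  ... | v∈U , u~v = record { u∈V = u∈V ; v∈V = v∈V ; u∈U = u∈U ; v∈U = v∈U ; u~v = u~v }

  innerEdge⇒maxDegree≡1 : (∀ u → U u ≡ true → degree u ≤ 1) → InnerEdge → inducedMaxDegree Γ U ≡ 1
  innerEdge⇒maxDegree≡1 deg≤1 e = ≤-antisym (maxDegree≤ deg≤1) (begin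
    1                        ≤⟨ tally-member _ v∈V (cong₂ _∧_ v∈U u~v) ⟩
    degree u                 ≤⟨ degree≤maxDegree u∈V u∈U ⟩
    inducedMaxDegree Γ U     ∎)
    where
    open InnerEdge e
    open ≤-Reasoning

vec-ext : {u v : Vec A m} → (∀ i → lookup u i ≡ lookup v i) → u ≡ v
vec-ext {u = u} {v} u≗v = begin
  u                       ≡⟨ tabulate∘lookup u ⟨
  Vec.tabulate (lookup u) ≡⟨ tabulate-cong u≗v ⟩
  Vec.tabulate (lookup v) ≡⟨ tabulate∘lookup v ⟩
  v                       ∎
  where open ≡-Reasoning

toggle : Fin m → Vec Bool m → Vec Bool m
toggle i a = updateAt a i not

lookup-toggle : (i : Fin m) (a : Vec Bool m) (j : Fin m) →
  lookup (toggle i a) j ≡ lookup a j xor ⌊ j ≟ᶠ i ⌋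
lookup-toggle i a j with j ≟ᶠ i
... | yes refl = trans (lookup∘updateAt j a) (sym (xor-true (lookup a j)))
... | no  j≢i  = trans (lookup∘updateAt′ j i j≢i a) (sym (xor-identityʳ (lookup a j)))

toggle-unique : (i : Fin m) (a b : Vec Bool m) →
  (∀ j → lookup b j ≡ lookup a j xor ⌊ j ≟ᶠ i ⌋) → b ≡ toggle i a
toggle-unique i a b b≗ = vec-ext (λ j → trans (b≗ j) (sym (lookup-toggle i a j)))

parity : (Fin m → Bool) → Vec Bool m → Bool
parity p []      = false
parity p (x ∷ a) = (p zero ∧ x) xor parity (p ∘ suc) a

parity-toggle : (p : Fin m → Bool) (i : Fin m) (a : Vec Bool m) →
  parity p (toggle i a) ≡ parity p a xor p i
parity-toggle p zero (x ∷ a) = head-flip (p zero) x (parity (p ∘ suc) a)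
  where
  head-flip : ∀ c x r → (c ∧ not x) xor r ≡ ((c ∧ x) xor r) xor c
  head-flip false x r = sym (xor-identityʳ r)
  head-flip true  x r = trans (sym (not-distribˡ-xor x r)) (sym (xor-true (x xor r)))
parity-toggle p (suc i) (x ∷ a) =
  trans (cong ((p zero ∧ x) xor_) (parity-toggle (p ∘ suc) i a))
        (sym (xor-assoc (p zero ∧ x) (parity (p ∘ suc) a) (p (suc i))))

parity-toggle-inside : (p : Fin m → Bool) {i : Fin m} → p i ≡ true → (a : Vec Bool m) →
  parity p (toggle i a) ≡ not (parity p a)
parity-toggle-inside p {i} i∈p a =
  trans (parity-toggle p i a) (trans (cong (parity p a xor_) i∈p) (xor-true (parity p a)))

parity-toggle-outside : (p : Fin m → Bool) {i : Fin m} → p i ≡ false → (a : Vec Bool m) →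
  parity p (toggle i a) ≡ parity p a
parity-toggle-outside p {i} i∉p a =
  trans (parity-toggle p i a) (trans (cong (parity p a xor_) i∉p) (xor-identityʳ (parity p a)))

parity-zero : (p : Fin m → Bool) → parity p (replicate m false) ≡ false
parity-zero {zero}  p = refl
parity-zero {suc m} p = trans (cong (_xor parity (p ∘ suc) (replicate m false)) (∧-zeroʳ (p zero)))
                              (parity-zero (p ∘ suc))

∑-allFin-suc : (f : Fin (suc m) → ℕ) → ∑ (allFin (suc m)) f ≡ f zero + ∑ (allFin m) (f ∘ suc)
∑-allFin-suc {m} f = cong (f zero +_) (begin
  ∑ (tabulate suc) f          ≡⟨ cong (λ xs → ∑ xs f) (map-tabulate (λ i → i) suc) ⟨
  ∑ (map suc (allFin m)) f    ≡⟨ ∑-map suc (allFin m) f ⟩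
  ∑ (allFin m) (f ∘ suc)      ∎)
  where open ≡-Reasoning

allFin-occurs-once : (g : Fin m) → tally (λ h → does (h ≟ᶠ g)) (allFin m) ≡ 1
allFin-occurs-once {suc m} g = begin
  tally (λ h → does (h ≟ᶠ g)) (allFin (suc m))
    ≡⟨ tally≡∑ _ (allFin (suc m)) ⟩
  ∑ (allFin (suc m)) (λ h → indicator (does (h ≟ᶠ g)))
    ≡⟨ ∑-allFin-suc (λ h → indicator (does (h ≟ᶠ g))) ⟩
  indicator (does (zero ≟ᶠ g)) + ∑ (allFin m) (λ h → indicator (does (suc h ≟ᶠ g)))
    ≡⟨ split g ⟩
  1 ∎
  where
  open ≡-Reasoning
  split : (g : Fin (suc m)) →
    indicator (does (zero ≟ᶠ g)) + ∑ (allFin m) (λ h → indicator (does (suc h ≟ᶠ g))) ≡ 1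
  split zero    = cong suc (∑-zero (allFin m))
  split (suc g) = trans (sym (tally≡∑ _ (allFin m))) (allFin-occurs-once g)

four-corners : (F : Bool → Bool → ℕ) (u v : Bool) →
  F u v + F (not u) v + F u (not v) + F (not u) (not v)
    ≡ F false false + F true false + F false true + F true true
four-corners F false false = refl
four-corners F true  false = swap (F true false) (F false false) (F true true) (F false true)
  where swap : ∀ a b c d → a + b + c + d ≡ b + a + d + c
        swap = solve-∀
four-corners F false true  = swap (F false true) (F true true) (F false false) (F true false)
  where swap : ∀ a b c d → a + b + c + d ≡ c + d + a + b
        swap = solve-∀
four-corners F true  true  = swap (F true true) (F false true) (F true false) (F false false)
  where swap : ∀ a b c d → a + b + c + d ≡ d + c + b + a
        swap = solve-∀

module Cube (G : FinGroup) where

  cube : (m : ℕ) → List (Vec Bool m)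
  cube = allVecs G

  ∑-cube-suc : (f : Vec Bool (suc m) → ℕ) →
    ∑ (cube (suc m)) f ≡ ∑ (cube m) (λ v → f (false ∷ v) + f (true ∷ v))
  ∑-cube-suc {m} f = split (cube m)
    where
    split : (vs : List (Vec Bool m)) →
      ∑ (concatMap (λ v → (false ∷ v) ∷ (true ∷ v) ∷ []) vs) f ≡ ∑ vs (λ v → f (false ∷ v) + f (true ∷ v))
    split []       = refl
    split (v ∷ vs) = trans (cong (λ r → f (false ∷ v) + (f (true ∷ v) + r)) (split vs))
                           (sym (+-assoc (f (false ∷ v)) (f (true ∷ v)) _))

  ∑-cube-const : (m k : ℕ) → ∑ (cube m) (λ _ → k) ≡ 2 ^ m * k
  ∑-cube-const zero    k = refl
  ∑-cube-const (suc m) k = begin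
    ∑ (cube (suc m)) (λ _ → k) ≡⟨ ∑-cube-suc {m} (λ _ → k) ⟩
    ∑ (cube m) (λ _ → k + k)   ≡⟨ ∑-cube-const m (k + k) ⟩
    2 ^ m * (k + k)            ≡⟨ double (2 ^ m) k ⟩
    2 ^ suc m * k              ∎
    where
    open ≡-Reasoning
    double : ∀ x k → x * (k + k) ≡ 2 * x * k
    double = solve-∀

  -- toggling a fixed lamp permutes the cube
  ∑-cube-toggle : (i : Fin m) (f : Vec Bool m → ℕ) → ∑ (cube m) f ≡ ∑ (cube m) (f ∘ toggle i)
  ∑-cube-toggle {suc m} zero f = begin
    ∑ (cube (suc m)) f                                  ≡⟨ ∑-cube-suc f ⟩
    ∑ (cube m) (λ v → f (false ∷ v) + f (true ∷ v))     ≡⟨ ∑-cong (λ v → +-comm (f (false ∷ v)) _) (cube m) ⟩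
    ∑ (cube m) (λ v → f (true ∷ v) + f (false ∷ v))     ≡⟨ ∑-cube-suc (f ∘ toggle zero) ⟨
    ∑ (cube (suc m)) (f ∘ toggle zero)                  ∎
    where open ≡-Reasoning
  ∑-cube-toggle {suc m} (suc i) f = begin
    ∑ (cube (suc m)) f                                  ≡⟨ ∑-cube-suc f ⟩
    ∑ (cube m) (λ v → f (false ∷ v) + f (true ∷ v))     ≡⟨ ∑-cube-toggle i _ ⟩
    ∑ (cube m) (λ v → f (false ∷ toggle i v) + f (true ∷ toggle i v))
                                                        ≡⟨ ∑-cube-suc (f ∘ toggle (suc i)) ⟨
    ∑ (cube (suc m)) (f ∘ toggle (suc i))               ∎
    where open ≡-Reasoning

  ∈-cube : (a : Vec Bool m) → a ∈ cube m
  ∈-cube []      = here refl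
  ∈-cube (x ∷ a) =
    ∈-concatMap⁺ (λ v → (false ∷ v) ∷ (true ∷ v) ∷ []) (Any.map (λ { refl → head-in-pair x }) (∈-cube a))
    where
    head-in-pair : ∀ x → x ∷ a ∈ (false ∷ a) ∷ (true ∷ a) ∷ []
    head-in-pair false = here refl
    head-in-pair true  = there (here refl)

  cube-occurs-once : (a : Vec Bool m) → tally (λ b → does (≡-dec _≟ᵇ_ b a)) (cube m) ≡ 1
  cube-occurs-once []      = refl
  cube-occurs-once {suc m} (x ∷ a) = begin
    tally (λ b → does (≡-dec _≟ᵇ_ b (x ∷ a))) (cube (suc m))
      ≡⟨ tally≡∑ _ (cube (suc m)) ⟩
    ∑ (cube (suc m)) (λ b → indicator (does (≡-dec _≟ᵇ_ b (x ∷ a))))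
      ≡⟨ ∑-cube-suc (λ b → indicator (does (≡-dec _≟ᵇ_ b (x ∷ a)))) ⟩
    ∑ (cube m) (λ v → indicator (does (false ≟ᵇ x) ∧ does (≡-dec _≟ᵇ_ v a))
                    + indicator (does (true ≟ᵇ x) ∧ does (≡-dec _≟ᵇ_ v a)))
      ≡⟨ ∑-cong (λ v → one-head x (does (≡-dec _≟ᵇ_ v a))) (cube m) ⟩
    ∑ (cube m) (λ v → indicator (does (≡-dec _≟ᵇ_ v a)))
      ≡⟨ tally≡∑ _ (cube m) ⟨
    tally (λ b → does (≡-dec _≟ᵇ_ b a)) (cube m)
      ≡⟨ cube-occurs-once a ⟩
    1 ∎
    where
    open ≡-Reasoning
    one-head : ∀ x r → indicator (does (false ≟ᵇ x) ∧ r) + indicator (does (true ≟ᵇ x) ∧ r) ≡ indicator r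
    one-head false r = +-identityʳ (indicator r)
    one-head true  r = refl

  parities-equidistributed : (p q : Fin m → Bool) {i₀ i₁ : Fin m} →
    p i₀ ≡ true → q i₀ ≡ false → p i₁ ≡ false → q i₁ ≡ true → (F : Bool → Bool → ℕ) →
    4 * ∑ (cube m) (λ a → F (parity p a) (parity q a))
      ≡ 2 ^ m * (F false false + F true false + F false true + F true true)
  parities-equidistributed {m} p q {i₀} {i₁} i₀∈p i₀∉q i₁∉p i₁∈q F = begin
    4 * σ                                               ≡⟨ four-copies σ ⟩
    σ + σ + σ + σ                                       ≡⟨ cong₂ _+_ (cong₂ _+_ (cong (σ +_) σ≡σ₀) σ≡σ₁) σ≡σ₀₁ ⟩
    σ + ∑ (cube m) (Φ ∘ t₀) + ∑ (cube m) (Φ ∘ t₁) + ∑ (cube m) (Φ ∘ t₀ ∘ t₁)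
                                                        ≡⟨ ∑-four ⟨
    ∑ (cube m) (λ a → Φ a + Φ (t₀ a) + Φ (t₁ a) + Φ (t₀ (t₁ a)))
                                                        ≡⟨ ∑-cong orbit (cube m) ⟩
    ∑ (cube m) (λ _ → K)                                ≡⟨ ∑-cube-const m K ⟩
    2 ^ m * K                                           ∎
    where
    open ≡-Reasoning
    Φ : Vec Bool m → ℕ
    Φ a = F (parity p a) (parity q a)
    σ K : ℕ
    σ = ∑ (cube m) Φ
    K = F false false + F true false + F false true + F true true
    t₀ t₁ : Vec Bool m → Vec Bool m
    t₀ = toggle i₀
    t₁ = toggle i₁

    σ≡σ₀ : σ ≡ ∑ (cube m) (Φ ∘ t₀)
    σ≡σ₀ = ∑-cube-toggle i₀ Φ
    σ≡σ₁ : σ ≡ ∑ (cube m) (Φ ∘ t₁)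
    σ≡σ₁ = ∑-cube-toggle i₁ Φ
    σ≡σ₀₁ : σ ≡ ∑ (cube m) (Φ ∘ t₀ ∘ t₁)
    σ≡σ₀₁ = trans σ≡σ₀ (∑-cube-toggle i₁ (Φ ∘ t₀))

    ∑-four : ∑ (cube m) (λ a → Φ a + Φ (t₀ a) + Φ (t₁ a) + Φ (t₀ (t₁ a)))
           ≡ σ + ∑ (cube m) (Φ ∘ t₀) + ∑ (cube m) (Φ ∘ t₁) + ∑ (cube m) (Φ ∘ t₀ ∘ t₁)
    ∑-four = begin
      ∑ (cube m) (λ a → Φ a + Φ (t₀ a) + Φ (t₁ a) + Φ (t₀ (t₁ a)))
        ≡⟨ ∑-+ (λ a → Φ a + Φ (t₀ a) + Φ (t₁ a)) (Φ ∘ t₀ ∘ t₁) (cube m) ⟩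
      ∑ (cube m) (λ a → Φ a + Φ (t₀ a) + Φ (t₁ a)) + ∑ (cube m) (Φ ∘ t₀ ∘ t₁)
        ≡⟨ cong (_+ ∑ (cube m) (Φ ∘ t₀ ∘ t₁)) (∑-+ (λ a → Φ a + Φ (t₀ a)) (Φ ∘ t₁) (cube m)) ⟩
      ∑ (cube m) (λ a → Φ a + Φ (t₀ a)) + ∑ (cube m) (Φ ∘ t₁) + ∑ (cube m) (Φ ∘ t₀ ∘ t₁)
        ≡⟨ cong (λ s → s + ∑ (cube m) (Φ ∘ t₁) + ∑ (cube m) (Φ ∘ t₀ ∘ t₁)) (∑-+ Φ (Φ ∘ t₀) (cube m)) ⟩
      σ + ∑ (cube m) (Φ ∘ t₀) + ∑ (cube m) (Φ ∘ t₁) + ∑ (cube m) (Φ ∘ t₀ ∘ t₁) ∎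

    flip₀ : ∀ a → Φ (t₀ a) ≡ F (not (parity p a)) (parity q a)
    flip₀ a = cong₂ F (parity-toggle-inside p i₀∈p a) (parity-toggle-outside q i₀∉q a)
    flip₁ : ∀ a → Φ (t₁ a) ≡ F (parity p a) (not (parity q a))
    flip₁ a = cong₂ F (parity-toggle-outside p i₁∉p a) (parity-toggle-inside q i₁∈q a)
    flip₀₁ : ∀ a → Φ (t₀ (t₁ a)) ≡ F (not (parity p a)) (not (parity q a))
    flip₀₁ a = trans (flip₀ (t₁ a)) (cong₂ F (cong not (parity-toggle-outside p i₁∉p a))
                                             (parity-toggle-inside q i₁∈q a))

    orbit : ∀ a → Φ a + Φ (t₀ a) + Φ (t₁ a) + Φ (t₀ (t₁ a)) ≡ K
    orbit a = trans (cong₂ _+_ (cong₂ _+_ (cong (Φ a +_) (flip₀ a)) (flip₁ a)) (flip₀₁ a))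
                    (four-corners F (parity p a) (parity q a))

    four-copies : ∀ s → 4 * s ≡ s + s + s + s
    four-copies = solve-∀

-- the counting inequality behind |Û| > |Ŵ|/2 : with P = 2^|G|, σ = |Û|,
-- u = |U|, b = |black|, w = |white|
majority-arith : ∀ P σ u b w → 0 < P → b ≤ w → b + w < 2 * u →
  4 * σ ≡ P * (u + b + w + w) → P * (b + w) < 2 * σ
majority-arith P σ u b w P>0 b≤w b+w<2u 4σ≡ = *-cancelˡ-< 2 _ _ (begin-strict
  2 * (P * (b + w))       ≡⟨ double P b w ⟩
  P * (b + b + w + w)     <⟨ *-monoʳ-< P {{>-nonZero P>0}} (+-monoˡ-< w (+-monoˡ-< w (+-monoˡ-< b b<u))) ⟩
  P * (u + b + w + w)     ≡⟨ 4σ≡ ⟨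
  4 * σ                   ≡⟨ *-assoc 2 2 σ ⟩
  2 * (2 * σ)             ∎)
  where
  open ≤-Reasoning
  b<u : b < u
  b<u = *-cancelˡ-< 2 b u (≤-<-trans (≤-trans (≤-reflexive (cong (b +_) (+-identityʳ b))) (+-monoʳ-≤ b b≤w)) b+w<2u)
  double : ∀ P b w → 2 * (P * (b + w)) ≡ P * (b + b + w + w)
  double = solve-∀
module Wreath (G : FinGroup) (S : Fin (FinGroup.n G) → Bool) where
  open FinGroup G
  open Cube G using (cube; cube-occurs-once; ∈-cube; ∑-cube-const; parities-equidistributed)

  group : Group _ _
  group = record { Carrier = Fin n ; _≈_ = _≡_ ; _∙_ = _∙_ ; ε = ε ; _⁻¹ = _⁻¹ ; isGroup = isGroup }
  open Group group using (inverseˡ)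
  open GroupProperties group using (\\-leftDividesʳ; inverseʳ-unique; ⁻¹-involutive)

  left-quotient≡ε : (g h : Fin n) → (g ⁻¹) ∙ h ≡ ε → h ≡ g
  left-quotient≡ε g h g⁻¹h≡ε = trans (inverseʳ-unique (g ⁻¹) h g⁻¹h≡ε) (⁻¹-involutive g)

  ⌊left-quotient≟ε⌋ : (g i : Fin n) → ⌊ (g ⁻¹) ∙ i ≟ᶠ ε ⌋ ≡ ⌊ i ≟ᶠ g ⌋
  ⌊left-quotient≟ε⌋ g i = ⌊⌋-agree (left-quotient≡ε g i) (λ { refl → inverseˡ g }) _ _

  Γ : FinGraph
  Γ = Cay G S

  Ŵ : FinGraph
  Ŵ = CayWr G S

  open FinGraph Ŵ using () renaming (adj to _~_)

  step : Wr G → Wr G → Wr G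
  step x y = _∙ʷ_ G (invʷ G x) y

  relative-lamps : (a : Z2G G) (g : Fin n) (b : Z2G G) (h i : Fin n) →
    lookup (proj₁ (step (a , g) (b , h))) ((g ⁻¹) ∙ i) ≡ lookup a i xor lookup b i
  relative-lamps a g b h i = begin
    lookup (_+ᶻ_ G (act G a (g ⁻¹)) (act G b (g ⁻¹))) ((g ⁻¹) ∙ i)
      ≡⟨ lookup-zipWith _xor_ ((g ⁻¹) ∙ i) (act G a (g ⁻¹)) (act G b (g ⁻¹)) ⟩
    lookup (act G a (g ⁻¹)) ((g ⁻¹) ∙ i) xor lookup (act G b (g ⁻¹)) ((g ⁻¹) ∙ i)
      ≡⟨ cong₂ _xor_ (lookup∘tabulate _ ((g ⁻¹) ∙ i)) (lookup∘tabulate _ ((g ⁻¹) ∙ i)) ⟩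
    lookup a (((g ⁻¹) ⁻¹) ∙ ((g ⁻¹) ∙ i)) xor lookup b (((g ⁻¹) ⁻¹) ∙ ((g ⁻¹) ∙ i))
      ≡⟨ cong (λ j → lookup a j xor lookup b j) (\\-leftDividesʳ (g ⁻¹) i) ⟩
    lookup a i xor lookup b i ∎
    where open ≡-Reasoning

  Ŝ-cases : (c : Z2G G) (k : Fin n) → Ŝ G S (c , k) ≡ true →
    (k ≡ ε × c ≡ aᶻ G ε) ⊎ (c ≡ eᶻ G × S k ≡ true)
  Ŝ-cases c k c,k∈Ŝ with k ≟ᶠ ε | ≡-dec _≟ᵇ_ c (aᶻ G ε) | ≡-dec _≟ᵇ_ c (eᶻ G)
  ... | yes k≡ε | yes c≡a₁ | _        = inj₁ (k≡ε , c≡a₁)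
  ... | yes _   | no _     | yes c≡e  = inj₂ (c≡e , c,k∈Ŝ)
  ... | no _    | _        | yes c≡e  = inj₂ (c≡e , c,k∈Ŝ)

  adjacency-cases : (a : Z2G G) (g : Fin n) (b : Z2G G) (h : Fin n) → (a , g) ~ (b , h) ≡ true →
    (h ≡ g × b ≡ toggle g a) ⊎ (b ≡ a × S ((g ⁻¹) ∙ h) ≡ true)
  adjacency-cases a g b h a,g~b,h
    with Ŝ-cases (proj₁ (step (a , g) (b , h))) ((g ⁻¹) ∙ h) a,g~b,h
  ... | inj₁ (k≡ε , c≡a₁) =
    inj₁ (left-quotient≡ε g h k≡ε ,
          toggle-unique g a b (λ i → xor-solve (lookup a i) _ _ (differ-at-g i)))
    where
    differ-at-g : ∀ i → lookup a i xor lookup b i ≡ ⌊ i ≟ᶠ g ⌋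
    differ-at-g i = begin
      lookup a i xor lookup b i                            ≡⟨ relative-lamps a g b h i ⟨
      lookup (proj₁ (step (a , g) (b , h))) ((g ⁻¹) ∙ i)   ≡⟨ cong (λ c → lookup c ((g ⁻¹) ∙ i)) c≡a₁ ⟩
      lookup (aᶻ G ε) ((g ⁻¹) ∙ i)                         ≡⟨ lookup∘tabulate _ ((g ⁻¹) ∙ i) ⟩
      ⌊ (g ⁻¹) ∙ i ≟ᶠ ε ⌋                                  ≡⟨ ⌊left-quotient≟ε⌋ g i ⟩
      ⌊ i ≟ᶠ g ⌋                                           ∎
      where open ≡-Reasoning
  ... | inj₂ (c≡e , s) =
    inj₂ (vec-ext (λ i → trans (xor-solve (lookup a i) _ _ (agree i)) (xor-identityʳ _)) , s)
    where
    agree : ∀ i → lookup a i xor lookup b i ≡ false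
    agree i = begin
      lookup a i xor lookup b i                            ≡⟨ relative-lamps a g b h i ⟨
      lookup (proj₁ (step (a , g) (b , h))) ((g ⁻¹) ∙ i)   ≡⟨ cong (λ c → lookup c ((g ⁻¹) ∙ i)) c≡e ⟩
      lookup (eᶻ G) ((g ⁻¹) ∙ i)                           ≡⟨ lookup-replicate ((g ⁻¹) ∙ i) false ⟩
      false                                                ∎
      where open ≡-Reasoning

  Ŝ-lamps-off : (k : Fin n) → S k ≡ true → Ŝ G S (eᶻ G , k) ≡ true
  Ŝ-lamps-off k s with ≡-dec _≟ᵇ_ (eᶻ G) (eᶻ G)
  ... | yes _   rewrite s = ∨-zeroʳ _
  ... | no e≢e  = contradiction refl e≢e

  act-lamps-off : (k : Fin n) → act G (eᶻ G) k ≡ eᶻ G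
  act-lamps-off k = vec-ext (λ x → trans (lookup∘tabulate _ x)
    (trans (lookup-replicate ((k ⁻¹) ∙ x) false) (sym (lookup-replicate x false))))

  lamps-off-edge : (g h : Fin n) → S ((g ⁻¹) ∙ h) ≡ true → (eᶻ G , g) ~ (eᶻ G , h) ≡ true
  lamps-off-edge g h s = subst (λ c → Ŝ G S (c , (g ⁻¹) ∙ h) ≡ true) (sym no-lamps) (Ŝ-lamps-off _ s)
    where
    no-lamps : _+ᶻ_ G (act G (eᶻ G) (g ⁻¹)) (act G (eᶻ G) (g ⁻¹)) ≡ eᶻ G
    no-lamps = trans (cong₂ (_+ᶻ_ G) (act-lamps-off (g ⁻¹)) (act-lamps-off (g ⁻¹)))
                     (zipWith-replicate _xor_ false false)

  ProperColouring : (Fin n → Bool) → Set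
  ProperColouring d = ∀ g h → S ((g ⁻¹) ∙ h) ≡ true → d g ≢ d h

  bipartite-lift : IsBipartite Γ → IsBipartite Ŵ
  bipartite-lift (c , c-proper) = ĉ , ĉ-proper
    where
    ĉ : Wr G → Bool
    ĉ (a , g) = c g xor parity (λ _ → true) a

    ĉ-proper : ∀ x y → x ~ y ≡ true → ĉ x ≢ ĉ y
    ĉ-proper (a , g) (b , h) x~y ĉx≡ĉy with adjacency-cases a g b h x~y
    ... | inj₁ (refl , refl) =
      not-¬ refl (trans ĉx≡ĉy (trans (cong (c g xor_) (parity-toggle-inside (λ _ → true) refl a))
                                     (sym (not-distribʳ-xor (c g) _))))
    ... | inj₂ (refl , s) = c-proper g h s (xor-cancelʳ (c g) (c h) _ ĉx≡ĉy)

  -- Given a proper 2-colouring d of Γ (black = true, white = false) and a set U of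
  -- maximum induced degree ≤ 1, Û is the union of three layers of Ŵ, selected by the
  -- parities of lit lamps on black and on white positions.
  module Lift (d : Fin n → Bool) (d-proper : ProperColouring d)
              (U : Fin n → Bool) (U-sparse : ∀ g → U g ≡ true → inducedDegree Γ U g ≤ 1) where

    white-parity black-parity : Z2G G → Bool
    white-parity = parity (not ∘ d)
    black-parity = parity d

    -- odd black parity: white positions; else odd white parity: black positions; else U
    layer : (u v δ μ : Bool) → Bool
    layer u v δ μ = if v then not δ else (if u then δ else μ)

    Û : Wr G → Bool
    Û (a , g) = layer (white-parity a) (black-parity a) (d g) (U g)

    toggle-stays-in-layer : ∀ u v δ μ → layer u v δ μ ≡ true →
      layer (u xor not δ) (v xor δ) δ μ ≡ true → v ≡ true
    toggle-stays-in-layer u     true  δ     μ _  _  = refl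
    toggle-stays-in-layer u     false true  μ _  ()
    toggle-stays-in-layer true  false false μ () _
    toggle-stays-in-layer false false false μ _  ()

    move-stays-in-layer : ∀ u v δ δ′ μ μ′ → layer u v δ μ ≡ true → layer u v δ′ μ′ ≡ true →
      δ ≢ δ′ → v ≡ false × u ≡ false × μ′ ≡ true
    move-stays-in-layer u     true  false false μ μ′ _ _  δ≢δ′ = contradiction refl δ≢δ′
    move-stays-in-layer true  false true  true  μ μ′ _ _  δ≢δ′ = contradiction refl δ≢δ′
    move-stays-in-layer false false δ     δ′    μ μ′ _ μ′∈ _   = refl , refl , μ′∈

    -- the only possible Û-neighbours of x ∈ Û are the vertices (target x , h) with h ∈ R x
    target : Wr G → Z2G G
    target (a , g) = if black-parity a then toggle g a else a

    R : Wr G → Fin n → Bool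
    R (a , g) h = if black-parity a then does (h ≟ᶠ g)
                  else (if white-parity a then false else (U h ∧ S ((g ⁻¹) ∙ h)))

    neighbours-confined : (x y : Wr G) → Û x ≡ true → (Û y ∧ x ~ y) ≡ true →
      (does (≡-dec _≟ᵇ_ (proj₁ y) (target x)) ∧ R x (proj₂ y)) ≡ true
    neighbours-confined (a , g) (b , h) x∈Û y∈Û∧x~y
      with ∧-true (Û (b , h)) _ y∈Û∧x~y
    ... | y∈Û , x~y with adjacency-cases a g b h x~y
    ... | inj₁ (refl , refl)
      with toggle-stays-in-layer (white-parity a) (black-parity a) (d g) (U g) x∈Û
             (subst₂ (λ u v → layer u v (d g) (U g) ≡ true)
                     (parity-toggle (not ∘ d) g a) (parity-toggle d g a) y∈Û)
    ...   | black-odd rewrite black-odd =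
      cong₂ _∧_ (dec-true (≡-dec _≟ᵇ_ (toggle g a) (toggle g a)) refl) (dec-true (g ≟ᶠ g) refl)
    neighbours-confined (a , g) (b , h) x∈Û y∈Û∧x~y
        | y∈Û , x~y | inj₂ (refl , s)
      with move-stays-in-layer (white-parity a) (black-parity a) (d g) (d h) (U g) (U h)
             x∈Û y∈Û (d-proper g h s)
    ... | black-even , white-even , h∈U rewrite black-even | white-even | h∈U | s =
      cong (_∧ true) (dec-true (≡-dec _≟ᵇ_ a a) refl)

    R-small : (x : Wr G) → Û x ≡ true → tally (R x) elems ≤ 1
    R-small (a , g) x∈Û with black-parity a | white-parity a
    ... | true  | _     = ≤-reflexive (allFin-occurs-once g)
    ... | false | true  = ≤-trans (≤-reflexive (trans (tally≡∑ _ elems) (∑-zero elems))) z≤n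
    ... | false | false = U-sparse g x∈Û

    -- as the lamp configuration target x occurs once in the cube, x has ≤ |R x| ≤ 1 Û-neighbours
    Û-sparse : (x : Wr G) → Û x ≡ true → inducedDegree Ŵ Û x ≤ 1
    Û-sparse x x∈Û = begin
      tally (λ y → Û y ∧ x ~ y) (wrElems G)
        ≤⟨ tally-mono _ _ (λ y → neighbours-confined x y x∈Û) (wrElems G) ⟩
      tally (λ (b , h) → does (≡-dec _≟ᵇ_ b (target x)) ∧ R x h) (wrElems G)
        ≡⟨ tally-product _ (R x) (cube n) elems ⟩
      tally (λ b → does (≡-dec _≟ᵇ_ b (target x))) (cube n) * tally (R x) elems
        ≡⟨ cong (_* tally (R x) elems) (cube-occurs-once (target x)) ⟩
      1 * tally (R x) elems
        ≡⟨ *-identityˡ _ ⟩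
      tally (R x) elems
        ≤⟨ R-small x x∈Û ⟩
      1 ∎
      where open ≤-Reasoning

    lamps-off-in-Û : (g : Fin n) → Û (eᶻ G , g) ≡ U g
    lamps-off-in-Û g rewrite parity-zero d | parity-zero (not ∘ d) = refl

    innerEdge-lift : InducedSubgraph.InnerEdge Γ U → InducedSubgraph.InnerEdge Ŵ Û
    innerEdge-lift e = record
      { u∈V = ∈-cartesianProduct⁺ (∈-cube (eᶻ G)) (∈-allFin u)
      ; v∈V = ∈-cartesianProduct⁺ (∈-cube (eᶻ G)) (∈-allFin v)
      ; u∈U = trans (lamps-off-in-Û u) u∈U
      ; v∈U = trans (lamps-off-in-Û v) v∈U
      ; u~v = lamps-off-edge u v u~v
      }
      where open InducedSubgraph.InnerEdge e

    -- a white g₀ and a black g₁ make the two parities equidistributed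
    count-Û : {g₀ g₁ : Fin n} → d g₀ ≡ false → d g₁ ≡ true →
      4 * tally Û (wrElems G)
        ≡ 2 ^ n * (tally U elems + tally d elems + tally (not ∘ d) elems + tally (not ∘ d) elems)
    count-Û g₀-white g₁-black = trans
      (cong (4 *_) (tally-cartesianProduct Û (cube n) elems))
      (parities-equidistributed (not ∘ d) d (cong not g₀-white) g₀-white (cong not g₁-black) g₁-black
        (λ u v → tally (λ g → layer u v (d g) (U g)) elems))

    count-Ŵ : length (wrElems G) ≡ 2 ^ n * (tally d elems + tally (not ∘ d) elems)
    count-Ŵ = begin
      length (wrElems G)                               ≡⟨ length≡∑ (wrElems G) ⟩
      ∑ (wrElems G) (λ _ → 1)                          ≡⟨ ∑-cartesianProduct (cube n) elems _ ⟩
      ∑ (cube n) (λ _ → ∑ elems (λ _ → 1))             ≡⟨ ∑-cube-const n _ ⟩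
      2 ^ n * ∑ elems (λ _ → 1)                        ≡⟨ cong (2 ^ n *_) (length≡∑ elems) ⟨
      2 ^ n * length elems                             ≡⟨ cong (2 ^ n *_) (tally-complement d elems) ⟨
      2 ^ n * (tally d elems + tally (not ∘ d) elems)  ∎
      where open ≡-Reasoning

    Û-large : {g₀ g₁ : Fin n} → d g₀ ≡ false → d g₁ ≡ true →
      tally d elems ≤ tally (not ∘ d) elems → 2 * tally U elems > length elems →
      2 * tally Û (wrElems G) > length (wrElems G)
    Û-large g₀-white g₁-black balanced U-large = subst (_< 2 * tally Û (wrElems G)) (sym count-Ŵ)
      (majority-arith (2 ^ n) (tally Û (wrElems G)) (tally U elems) _ _ (m^n>0 2 n) balanced
        (subst (_< 2 * tally U elems) (sym (tally-complement d elems)) U-large)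
        (count-Û g₀-white g₁-black))

  balanced-colouring : IsBipartite Γ →
    Σ[ d ∈ (Fin n → Bool) ] ProperColouring d × tally d elems ≤ tally (not ∘ d) elems
  balanced-colouring (c , c-proper) with ≤-total (tally c elems) (tally (not ∘ c) elems)
  ... | inj₁ c-smaller = c , c-proper , c-smaller
  ... | inj₂ not-c-smaller =
    not ∘ c , (λ g h s eq → c-proper g h s (not-injective eq)) ,
    ≤-trans not-c-smaller (tally-mono _ _ (λ g c≡t → trans (not-involutive (c g)) c≡t) elems)

  both-colours : (d : Fin n → Bool) {g h : Fin n} → d g ≢ d h →
    Σ[ g₀ ∈ Fin n ] Σ[ g₁ ∈ Fin n ] d g₀ ≡ false × d g₁ ≡ true
  both-colours d {g} {h} dg≢dh with d g in dg | d h in dh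
  ... | false | false = contradiction refl dg≢dh
  ... | false | true  = g , h , dg , dh
  ... | true  | false = h , g , dh , dg
  ... | true  | true  = contradiction refl dg≢dh

  large-sparse-lift : IsBipartite Γ → HasLargeMaxDeg1Subgraph Γ → HasLargeMaxDeg1Subgraph Ŵ
  large-sparse-lift Γ-bipartite (U , U-large , U-max≡1)
    with balanced-colouring Γ-bipartite
       | InducedSubgraph.maxDegree≡1⇒innerEdge Γ U U-max≡1
  ... | d , d-proper , balanced | edge
    with both-colours d (d-proper _ _ (InducedSubgraph.InnerEdge.u~v edge))
  ... | g₀ , g₁ , g₀-white , g₁-black =
    Û , Û-large g₀-white g₁-black balanced U-large ,
    InducedSubgraph.innerEdge⇒maxDegree≡1 Ŵ Û Û-sparse (innerEdge-lift edge)
    where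
    open InducedSubgraph Γ U using (degree≤maxDegree)
    U-sparse : ∀ g → U g ≡ true → inducedDegree Γ U g ≤ 1
    U-sparse g g∈U = ≤-trans (degree≤maxDegree (∈-allFin g) g∈U) (≤-reflexive U-max≡1)
    open Lift d d-proper U U-sparse

lemma4p1 : (G : FinGroup) (S : Fin (FinGroup.n G) → Bool) →
    InverseClosed G S → Generates G S → S (FinGroup.ε G) ≡ false →
    IsBipartite (Cay G S) → HasLargeMaxDeg1Subgraph (Cay G S) →
    IsBipartite (CayWr G S) × HasLargeMaxDeg1Subgraph (CayWr G S)
lemma4p1 G S _ _ _ Γ-bipartite Γ-large =
  bipartite-lift Γ-bipartite , large-sparse-lift Γ-bipartite Γ-large
  where open Wreath G S
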